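{- Let $x,m,n$ be non-negative integers and let $1\le a_1<\dots<a_m\le m+n$ and $1\le b_1<\dots<b_n\le m+n$ be integers. Then the region $S_{x}((a_i)_{i=1}^{m};(b_j)_{j=1}^{n})$ admits a lozenge tiling if and only if \[ |\{a_i\}_{i=1}^{m}\cap[t]|+|\{b_j\}_{j=1}^{n}\cap[t]|\leq t\quad\text{for every } t=1,2,\dots,m+n, \] where $[t]=\{1,2,\dots,t\}$.
   Context: Work on the triangular lattice with unit side length and horizontal lattice lines; a lozenge is the union of two unit triangles sharing an edge, and a tiling is a covering of a region by lozenges without gaps or overlaps. The region $S_x((a_i);(b_j))$: take the trapezoid with horizontal top side of length $x$, horizontal base of length $x+m+n$, and left and right sides of length $m+n$ at $60^\circ$ to the base; its rows are numbered $1,\dots,m+n$ from top to bottom, and the leftmost and rightmost unit triangles of each row are up-pointing. Remove the leftmost unit triangle of rows $a_1,\dots,a_m$ and the rightmost unit triangle of rows $b_1,\dots,b_n$. -}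

module Defs where

open import Data.Nat using (ℕ; zero; suc; _+_; _≤_; _<_; _≤?_)
open import Data.Fin using (Fin)
open import Data.List using (List; []; _∷_; length; filter; concatMap)
open import Data.List.Base using (allFin)
open import Data.List.Membership.Propositional using (_∈_)
open import Data.List.Relation.Unary.Unique.Propositional using (Unique)
open import Data.Product using (Σ; ∃; _×_; _,_; proj₁)
open import Relation.Binary.PropositionalEquality using (_≡_)
open import Relation.Nullary using (¬_)
open import Function.Bundles using (_⇔_)

-- Coordinates on the trapezoid S_x: a unit triangle is given by its
-- orientation, its row r (1 = top row, m+n = bottom row) and its position k
-- within the row counted from the left among triangles of the same
-- orientation (starting at 0).  Row r has x+r up-pointing triangles
-- (positions 0 .. x+r-1) and x+r-1 down-pointing triangles; the down
-- triangle at position k lies between up triangles k and k+1.  The top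
-- (horizontal) edge of down triangle k in row r+1 is the bottom edge of up
-- triangle k in row r.

data Orient : Set where
  up down : Orient

record Triangle : Set where
  constructor tri
  field
    orient : Orient
    row    : ℕ
    pos    : ℕ

InSeq : {m : ℕ} → (Fin m → ℕ) → ℕ → Set
InSeq a r = ∃ λ i → a i ≡ r

InRegion : (x m n : ℕ) → (Fin m → ℕ) → (Fin n → ℕ) → Triangle → Set
InRegion x m n a b (tri up r k) =
  1 ≤ r × r ≤ m + n × k < x + r
  × ¬ (k ≡ 0 × InSeq a r)
  × ¬ (suc k ≡ x + r × InSeq b r)
InRegion x m n a b (tri down r k) =
  1 ≤ r × r ≤ m + n × suc k < x + r

data Adjacent : Triangle → Triangle → Set where
  adj-right : ∀ {r k} → Adjacent (tri up r k) (tri down r k)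
  adj-left  : ∀ {r k} → Adjacent (tri up r (suc k)) (tri down r k)
  adj-below : ∀ {r k} → Adjacent (tri up r k) (tri down (suc r) k)

Lozenge : Set
Lozenge = Σ (Triangle × Triangle) λ p → Adjacent (proj₁ p) (Data.Product.proj₂ p)

cells : List Lozenge → List Triangle
cells = concatMap (λ l → proj₁ (proj₁ l) ∷ Data.Product.proj₂ (proj₁ l) ∷ [])

IsTiling : (x m n : ℕ) → (Fin m → ℕ) → (Fin n → ℕ) → List Lozenge → Set
IsTiling x m n a b ls =
  (∀ t → (t ∈ cells ls) ⇔ InRegion x m n a b t) × Unique (cells ls)

Tileable : (x m n : ℕ) → (Fin m → ℕ) → (Fin n → ℕ) → Set
Tileable x m n a b = ∃ λ ls → IsTiling x m n a b ls

-- |{a_i} ∩ [t]| (the a_i are distinct, so this counts indices i with a_i ≤ t)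
countLE : {m : ℕ} → (Fin m → ℕ) → ℕ → ℕ
countLE {m} a t = length (filter (λ i → a i ≤? t) (allFin m))

-- Write A r and B r for the numbers of a's and b's that are at most r.
--
-- Necessity: rows t + 1, …, m + n contain m + n − t more up- than down-pointing triangles.
-- Each up triangle there is either one of the (m − A t) + (n − B t) removed ones or the top
-- of a lozenge whose bottom lies in these rows too, so m + n − t ≤ (m − A t) + (n − B t).
--
-- Sufficiency: an explicit tiling. The down triangle at position k of row r + 1 forms a
-- vertical lozenge with the up triangle above it when A r ≤ k < r − B r. Left of this window
-- it is paired inside its row with its right neighbour if row r + 1 lost its leftmost
-- triangle and with its left neighbour otherwise; right of the window, with its left
-- neighbour if row r + 1 lost its rightmost triangle and with its right neighbour otherwise.
-- As A r + B r ≤ r the three zones are disjoint, and the chosen up triangle determines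
-- (r , k) again, so these lozenges are disjoint and cover exactly the region.

module Submission where

open import Defs
open import Data.Nat using (ℕ; _+_; _≤_; _<_)
open import Data.Fin using (Fin)
import Data.Fin
open import Data.Product using (_×_)
open import Function.Bundles using (_⇔_)

open import Data.Bool using (Bool; true; false)
open import Data.Fin.Properties as Fin using (any?)
open import Data.List using (List; []; _∷_; _++_; length; map; filter; upTo; allFin)
open import Data.List.Properties
  using ( map-∘; length-map; length-++; length-upTo; length-tabulate; length-removeAt′
        ; filter-all; filter-none; filter-some )
open import Data.List.Membership.Propositional using (_∈_)
open import Data.List.Membership.Propositional.Properties
open import Data.List.Relation.Binary.Subset.Propositional using (_⊆_)
open import Data.List.Relation.Unary.All as All using (All; []; _∷_)
import Data.List.Relation.Unary.All.Properties as All
import Data.List.Relation.Unary.AllPairs.Properties as AllPairs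
open import Data.List.Relation.Unary.Any as Any using (here; there; _─_; index)
open import Data.List.Relation.Unary.Unique.Propositional using (Unique; []; _∷_)
import Data.List.Relation.Unary.Unique.Propositional.Properties as Unique
open import Data.Nat using (zero; suc; pred; _∸_; z≤n; s≤s; _≤?_; _<?_; _≟_)
open import Data.Nat.Properties
open import Algebra.Properties.CommutativeSemigroup +-commutativeSemigroup
  using () renaming (interchange to +-interchange)
open import Data.Product using (∃; ∃₂; _,_; proj₁; proj₂)
open import Data.Sum using (_⊎_; inj₁; inj₂)
open import Function using (_∘_)
open import Function.Bundles using (Equivalence; mk⇔)
open import Function.Definitions using (Injective)
open import Relation.Binary.Definitions using (tri<; tri≈; tri>)
open import Relation.Binary.PropositionalEquality
open import Relation.Nullary using (¬_; Dec; yes; no; ¬?; contradiction)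
open import Relation.Nullary.Decidable using (_×-dec_; does; dec-true; dec-false)
open import Relation.Unary using (Decidable)
open import Relation.Unary.Properties using (∁?)

module _ {A : Set} where

  ∈-─⁺ : ∀ {v w : A} {ys} (v∈ys : v ∈ ys) → w ∈ ys → w ≢ v → w ∈ (ys ─ v∈ys)
  ∈-─⁺ (here refl) (here refl) w≢v = contradiction refl w≢v
  ∈-─⁺ (here _)    (there w∈ys) _  = w∈ys
  ∈-─⁺ (there _)   (here refl)  _  = here refl
  ∈-─⁺ (there v∈ys) (there w∈ys) w≢v = there (∈-─⁺ v∈ys w∈ys w≢v)

  unique-⊆⇒length≤ : ∀ {xs ys : List A} → Unique xs → xs ⊆ ys → length xs ≤ length ys
  unique-⊆⇒length≤ {[]}          _              _   = z≤n
  unique-⊆⇒length≤ {x ∷ xs} {ys} (x∉xs ∷ !xs) xs⊆ys = begin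
    suc (length xs)           ≤⟨ s≤s (unique-⊆⇒length≤ !xs xs⊆ys─x) ⟩
    suc (length (ys ─ x∈ys))  ≡⟨ length-removeAt′ ys (index x∈ys) ⟨
    length ys                 ∎
    where
    open ≤-Reasoning
    x∈ys = xs⊆ys (here refl)
    xs⊆ys─x : xs ⊆ (ys ─ x∈ys)
    xs⊆ys─x w∈xs = ∈-─⁺ x∈ys (xs⊆ys (there w∈xs)) (≢-sym (All.lookup x∉xs w∈xs))

  map⁺-injectiveOn : ∀ {B : Set} {f : A → B} {xs} →
    (∀ {y z} → y ∈ xs → z ∈ xs → f y ≡ f z → y ≡ z) → Unique xs → Unique (map f xs)
  map⁺-injectiveOn {xs = []}     _   []          = []
  map⁺-injectiveOn {xs = x ∷ xs} inj (x∉xs ∷ !xs) =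
    All.map⁺ (All.tabulate λ y∈xs fx≡fy → All.lookup x∉xs y∈xs (inj (here refl) (there y∈xs) fx≡fy))
    ∷ map⁺-injectiveOn (λ y∈ z∈ → inj (there y∈) (there z∈)) !xs

  module _ {P : A → Set} (P? : Decidable P) where

    length-filter+filter-∁ : ∀ xs → length (filter P? xs) + length (filter (∁? P?) xs) ≡ length xs
    length-filter+filter-∁ []       = refl
    length-filter+filter-∁ (x ∷ xs) with P? x
    ... | yes _ = cong suc (length-filter+filter-∁ xs)
    ... | no  _ = trans (+-suc _ _) (cong suc (length-filter+filter-∁ xs))

  module _ {P Q : A → Set} (P? : Decidable P) (Q? : Decidable Q) where

    filter-congOn : ∀ xs → All (λ x → P x ⇔ Q x) xs → filter P? xs ≡ filter Q? xs
    filter-congOn []       []            = refl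
    filter-congOn (x ∷ xs) (Px⇔Qx ∷ P⇔Q) with P? x | Q? x
    ... | yes _  | yes _  = cong (x ∷_) (filter-congOn xs P⇔Q)
    ... | no  _  | no  _  = filter-congOn xs P⇔Q
    ... | yes Px | no ¬Qx = contradiction (Equivalence.to Px⇔Qx Px) ¬Qx
    ... | no ¬Px | yes Qx = contradiction (Equivalence.from Px⇔Qx Qx) ¬Px

    length-filter-congExcept : ∀ {x} xs → Unique xs → x ∈ xs → P x → ¬ Q x →
      All (λ y → y ≢ x → P y ⇔ Q y) xs → length (filter P? xs) ≡ suc (length (filter Q? xs))
    length-filter-congExcept {x} (y ∷ xs) (y∉xs ∷ _) (here refl) Px ¬Qx (_ ∷ P⇔Q) with P? x | Q? x
    ... | yes _  | no _  = cong (suc ∘ length) (filter-congOn xs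
                             (All.zipWith (λ (y≢x , P⇔Q) → P⇔Q (≢-sym y≢x)) (y∉xs , P⇔Q)))
    ... | no ¬Px | _     = contradiction Px ¬Px
    ... | _      | yes Qx = contradiction Qx ¬Qx
    length-filter-congExcept {x} (y ∷ xs) (y∉xs ∷ !xs) (there x∈xs) Px ¬Qx (Py⇔Qy ∷ P⇔Q) with P? y | Q? y
    ... | yes _  | yes _  = cong suc (length-filter-congExcept xs !xs x∈xs Px ¬Qx P⇔Q)
    ... | no  _  | no  _  = length-filter-congExcept xs !xs x∈xs Px ¬Qx P⇔Q
    ... | yes Py | no ¬Qy = contradiction (Equivalence.to (Py⇔Qy y≢x) Py) ¬Qy
      where y≢x = All.lookup y∉xs x∈xs
    ... | no ¬Py | yes Qy = contradiction (Equivalence.from (Py⇔Qy y≢x) Qy) ¬Py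
      where y≢x = All.lookup y∉xs x∈xs

strictMono⇒injective : ∀ {k} {f : Fin k → ℕ} →
  (∀ i j → i Data.Fin.< j → f i < f j) → Injective _≡_ _≡_ f
strictMono⇒injective {f = f} mono {i} {j} fi≡fj with Fin.<-cmp i j
... | tri< i<j _ _ = contradiction fi≡fj (<⇒≢ (mono i j i<j))
... | tri≈ _ i≡j _ = i≡j
... | tri> _ _ j<i = contradiction (sym fi≡fj) (<⇒≢ (mono j i j<i))

≤suc⇔≤ : ∀ {n r} → n ≢ suc r → n ≤ suc r ⇔ n ≤ r
≤suc⇔≤ n≢1+r = mk⇔ (λ n≤1+r → ≤-pred (≤∧≢⇒< n≤1+r n≢1+r)) m≤n⇒m≤1+n

module _ {k : ℕ} (f : Fin k → ℕ) where

  InSeq? : ∀ r → Dec (InSeq f r)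
  InSeq? r = any? (λ i → f i ≟ r)

  countLE-zero : (∀ i → 1 ≤ f i) → countLE f 0 ≡ 0
  countLE-zero 1≤f = cong length (filter-none (λ i → f i ≤? 0)
    (All.tabulate {xs = allFin k} λ {i} _ fi≤0 → n≮0 (<-≤-trans (1≤f i) fi≤0)))

  countLE-all : ∀ {T} → (∀ i → f i ≤ T) → countLE f T ≡ k
  countLE-all f≤T = trans
    (cong length (filter-all (λ i → f i ≤? _) (All.tabulate {xs = allFin k} λ {i} _ → f≤T i)))
    (length-tabulate (λ i → i))

  InSeq⇒1≤countLE : ∀ {r} → InSeq f r → 1 ≤ countLE f r
  InSeq⇒1≤countLE (i , refl) = filter-some (λ j → f j ≤? f i) (Any.map (λ { refl → ≤-refl }) (∈-allFin i))

  countLE-suc-∈ : Injective _≡_ _≡_ f → ∀ {r} → InSeq f (suc r) → countLE f (suc r) ≡ suc (countLE f r)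
  countLE-suc-∈ inj {r} (i , fi≡) =
    length-filter-congExcept (λ j → f j ≤? suc r) (λ j → f j ≤? r) (allFin k)
      (Unique.allFin⁺ k) (∈-allFin i) (≤-reflexive fi≡) (λ fi≤r → n≮n r (subst (_≤ r) fi≡ fi≤r))
      (All.tabulate λ _ j≢i → ≤suc⇔≤ λ fj≡ → j≢i (inj (trans fj≡ (sym fi≡))))

  countLE-suc-∉ : ∀ {r} → ¬ InSeq f (suc r) → countLE f (suc r) ≡ countLE f r
  countLE-suc-∉ {r} ∉f = cong length (filter-congOn (λ j → f j ≤? suc r) (λ j → f j ≤? r) (allFin k)
    (All.tabulate λ {i} _ → ≤suc⇔≤ λ fi≡ → ∉f (i , fi≡)))

  countLE+count> : ∀ t → countLE f t + length (filter (∁? (λ i → f i ≤? t)) (allFin k)) ≡ k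
  countLE+count> t = trans (length-filter+filter-∁ (λ i → f i ≤? t) (allFin k)) (length-tabulate (λ i → i))

open Triangle using (orient; row; pos)

upOf downOf : Lozenge → Triangle
upOf   = proj₁ ∘ proj₁
downOf = proj₂ ∘ proj₁

orient-upOf : ∀ l → orient (upOf l) ≡ up
orient-upOf (_ , adj-right) = refl
orient-upOf (_ , adj-left)  = refl
orient-upOf (_ , adj-below) = refl

orient-downOf : ∀ l → orient (downOf l) ≡ down
orient-downOf (_ , adj-right) = refl
orient-downOf (_ , adj-left)  = refl
orient-downOf (_ , adj-below) = refl

row-upOf≤row-downOf : ∀ l → row (upOf l) ≤ row (downOf l)
row-upOf≤row-downOf (_ , adj-right) = ≤-refl
row-upOf≤row-downOf (_ , adj-left)  = ≤-refl
row-upOf≤row-downOf (_ , adj-below) = n≤1+n _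

upOf≢downOf : ∀ l l′ → upOf l ≢ downOf l′
upOf≢downOf l l′ eq with () ← trans (sym (orient-upOf l)) (trans (cong orient eq) (orient-downOf l′))

upOf∈cells : ∀ {l ls} → l ∈ ls → upOf l ∈ cells ls
upOf∈cells (here refl)  = here refl
upOf∈cells (there l∈ls) = there (there (upOf∈cells l∈ls))

downOf∈cells : ∀ {l ls} → l ∈ ls → downOf l ∈ cells ls
downOf∈cells (here refl)  = there (here refl)
downOf∈cells (there l∈ls) = there (there (downOf∈cells l∈ls))

∈-cells⁻ : ∀ {v} ls → v ∈ cells ls → ∃ λ l → l ∈ ls × (v ≡ upOf l ⊎ v ≡ downOf l)
∈-cells⁻ (l ∷ ls) (here v≡)         = l , here refl , inj₁ v≡
∈-cells⁻ (l ∷ ls) (there (here v≡)) = l , here refl , inj₂ v≡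
∈-cells⁻ (l ∷ ls) (there (there v∈)) with l′ , l′∈ , v≡ ← ∈-cells⁻ ls v∈ = l′ , there l′∈ , v≡

∈-cells-up⁻ : ∀ {v} ls → v ∈ cells ls → orient v ≡ up → ∃ λ l → l ∈ ls × upOf l ≡ v
∈-cells-up⁻ ls v∈ v-up with ∈-cells⁻ ls v∈
... | l , l∈ls , inj₁ v≡ = l , l∈ls , sym v≡
... | l , l∈ls , inj₂ v≡ with () ← trans (sym v-up) (trans (cong orient v≡) (orient-downOf l))

cells-unique : ∀ ls → Unique (map upOf ls) → Unique (map downOf ls) → Unique (cells ls)
cells-unique []       _              _              = []
cells-unique (l ∷ ls) (u∉ups ∷ !ups) (d∉downs ∷ !downs) =
  (upOf≢downOf l l ∷ All.tabulate up∉) ∷ All.tabulate down∉ ∷ cells-unique ls !ups !downs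
  where
  up∉ : ∀ {v} → v ∈ cells ls → upOf l ≢ v
  up∉ v∈ with ∈-cells⁻ ls v∈
  ... | l′ , l′∈ , inj₁ refl = All.lookup u∉ups (∈-map⁺ upOf l′∈)
  ... | l′ , l′∈ , inj₂ refl = upOf≢downOf l l′
  down∉ : ∀ {v} → v ∈ cells ls → downOf l ≢ v
  down∉ v∈ with ∈-cells⁻ ls v∈
  ... | l′ , l′∈ , inj₁ refl = upOf≢downOf l′ l ∘ sym
  ... | l′ , l′∈ , inj₂ refl = All.lookup d∉downs (∈-map⁺ downOf l′∈)

unique-cells⇒unique-downOf : ∀ ls → Unique (cells ls) → Unique (map downOf ls)
unique-cells⇒unique-downOf []       _                  = []
unique-cells⇒unique-downOf (l ∷ ls) (_ ∷ d∉cells ∷ !cells) =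
  All.map⁺ (All.tabulate λ l′∈ → All.lookup d∉cells (downOf∈cells l′∈))
  ∷ unique-cells⇒unique-downOf ls !cells

horizontal : {P : Set} → Dec P → ℕ → ℕ → Lozenge
horizontal (yes _) r k = (tri up r (suc k) , tri down r k) , adj-left
horizontal (no _)  r k = (tri up r k , tri down r k) , adj-right

vertical : ℕ → ℕ → Lozenge
vertical r k = (tri up r k , tri down (suc r) k) , adj-below

downOf-horizontal : ∀ {P : Set} (d : Dec P) r k → downOf (horizontal d r k) ≡ tri down r k
downOf-horizontal (yes _) r k = refl
downOf-horizontal (no _)  r k = refl

<⇒suc<+suc : ∀ {k} x r → k < x + r → suc k < x + suc r
<⇒suc<+suc {k} x r k<x+r = subst (suc k <_) (sym (+-suc x r)) (s≤s k<x+r)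

suc<+suc⇒< : ∀ {k} x r → suc k < x + suc r → k < x + r
suc<+suc⇒< {k} x r 1+k<x+1+r = ≤-pred (subst (suc k <_) (+-suc x r) 1+k<x+1+r)

module Rows (x : ℕ) where

  width : Orient → ℕ → ℕ
  width up   r = x + r
  width down r = pred (x + r)

  rowTriangles : Orient → ℕ → List Triangle
  rowTriangles o r = map (tri o r) (upTo (width o r))

  -- rows s + 1, …, s + l
  rowsBelow : Orient → ℕ → ℕ → List Triangle
  rowsBelow o s zero    = []
  rowsBelow o s (suc l) = rowTriangles o (suc s) ++ rowsBelow o (suc s) l

  ∈-rowsBelow⁺ : ∀ {o R k} s l → s < R → R ≤ s + l → k < width o R → tri o R k ∈ rowsBelow o s l
  ∈-rowsBelow⁺ s zero s<R R≤s+0 _ = contradiction (≤-trans s<R (subst (_ ≤_) (+-identityʳ s) R≤s+0)) (n≮n s)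
  ∈-rowsBelow⁺ {o} {R} s (suc l) s<R R≤s+1+l k<w with suc s ≟ R
  ... | yes refl = ∈-++⁺ˡ (∈-map⁺ (tri o R) (∈-upTo⁺ k<w))
  ... | no 1+s≢R = ∈-++⁺ʳ (rowTriangles o (suc s))
                     (∈-rowsBelow⁺ (suc s) l (≤∧≢⇒< s<R 1+s≢R) (subst (R ≤_) (+-suc s l) R≤s+1+l) k<w)

  ∈-rowsBelow⁻ : ∀ {o v} s l → v ∈ rowsBelow o s l →
    ∃₂ λ R k → v ≡ tri o R k × s < R × R ≤ s + l × k < width o R
  ∈-rowsBelow⁻ {o} s (suc l) v∈ with ∈-++⁻ (rowTriangles o (suc s)) v∈
  ... | inj₁ v∈row with k , k∈ , refl ← ∈-map⁻ (tri o (suc s)) v∈row =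
        suc s , k , refl , ≤-refl , subst (suc s ≤_) (sym (+-suc s l)) (s≤s (m≤m+n s l)) , ∈-upTo⁻ k∈
  ... | inj₂ v∈rows with R , k , refl , 1+s<R , R≤ , k<w ← ∈-rowsBelow⁻ (suc s) l v∈rows =
        R , k , refl , <⇒≤ 1+s<R , subst (R ≤_) (sym (+-suc s l)) R≤ , k<w

  tri-injective : ∀ {o r i j} → tri o r i ≡ tri o r j → i ≡ j
  tri-injective refl = refl

  rowsBelow-unique : ∀ o s l → Unique (rowsBelow o s l)
  rowsBelow-unique o s zero    = []
  rowsBelow-unique o s (suc l) =
    Unique.++⁺ (Unique.map⁺ tri-injective (Unique.upTo⁺ _)) (rowsBelow-unique o (suc s) l) disjoint
    where
    disjoint : ∀ {v} → ¬ (v ∈ rowTriangles o (suc s) × v ∈ rowsBelow o (suc s) l)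
    disjoint (v∈row , v∈rows) with ∈-map⁻ (tri o (suc s)) v∈row
    ... | _ , _ , refl with _ , _ , refl , 1+s<1+s , _ ← ∈-rowsBelow⁻ (suc s) l v∈rows = n≮n _ 1+s<1+s

  length-rowTriangles : ∀ o r → length (rowTriangles o r) ≡ width o r
  length-rowTriangles o r = trans (length-map (tri o r) (upTo (width o r))) (length-upTo (width o r))

  length-rowsBelow : ∀ s l → length (rowsBelow up s l) ≡ length (rowsBelow down s l) + l
  length-rowsBelow s zero    = refl
  length-rowsBelow s (suc l) = begin
    length (rowTriangles up (suc s) ++ rowsBelow up (suc s) l)
      ≡⟨ length-++ (rowTriangles up (suc s)) ⟩
    length (rowTriangles up (suc s)) + length (rowsBelow up (suc s) l)
      ≡⟨ cong₂ _+_ length-up (length-rowsBelow (suc s) l) ⟩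
    suc (length (rowTriangles down (suc s))) + (length (rowsBelow down (suc s) l) + l)
      ≡⟨ cong suc (+-assoc (length (rowTriangles down (suc s))) _ l) ⟨
    suc (length (rowTriangles down (suc s)) + length (rowsBelow down (suc s) l) + l)
      ≡⟨ +-suc _ l ⟨
    length (rowTriangles down (suc s)) + length (rowsBelow down (suc s) l) + suc l
      ≡⟨ cong (_+ suc l) (length-++ (rowTriangles down (suc s))) ⟨
    length (rowsBelow down s (suc l)) + suc l
      ∎
    where
    open ≡-Reasoning
    length-up : length (rowTriangles up (suc s)) ≡ suc (length (rowTriangles down (suc s)))
    length-up = begin
      length (rowTriangles up (suc s))        ≡⟨ length-rowTriangles up (suc s) ⟩
      x + suc s                               ≡⟨ +-suc x s ⟩
      suc (pred (suc (x + s)))                ≡⟨ cong (suc ∘ pred) (+-suc x s) ⟨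
      suc (width down (suc s))                ≡⟨ cong suc (length-rowTriangles down (suc s)) ⟨
      suc (length (rowTriangles down (suc s))) ∎

≤-from-complements : ∀ {p p′ q q′ s L} → (p + p′) + (q + q′) ≡ s + L → L ≤ p′ + q′ → p + q ≤ s
≤-from-complements {p} {p′} {q} {q′} {s} {L} total L≤ = +-cancelʳ-≤ L (p + q) s (begin
  p + q + L            ≤⟨ +-monoʳ-≤ (p + q) L≤ ⟩
  p + q + (p′ + q′)    ≡⟨ +-interchange p q p′ q′ ⟩
  (p + p′) + (q + q′)  ≡⟨ total ⟩
  s + L                ∎)
  where open ≤-Reasoning

module Necessity (x m n : ℕ) (a : Fin m → ℕ) (b : Fin n → ℕ)
                 (ls : List Lozenge) (tiling : IsTiling x m n a b ls) where

  open Rows x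

  removed-or-inRegion : ∀ {R k} → 1 ≤ R → R ≤ m + n → k < x + R →
    (k ≡ 0 × InSeq a R) ⊎ (suc k ≡ x + R × InSeq b R) ⊎ InRegion x m n a b (tri up R k)
  removed-or-inRegion {R} {k} 1≤R R≤N k<w with (k ≟ 0) ×-dec InSeq? a R
  ... | yes removedLeft = inj₁ removedLeft
  ... | no ¬removedLeft with (suc k ≟ x + R) ×-dec InSeq? b R
  ...   | yes removedRight = inj₂ (inj₁ removedRight)
  ...   | no ¬removedRight = inj₂ (inj₂ (1≤R , R≤N , k<w , ¬removedLeft , ¬removedRight))

  covers : ∀ v → v ∈ cells ls ⇔ InRegion x m n a b v
  covers = proj₁ tiling

  countLE-bound : ∀ t → t ≤ m + n → countLE a t + countLE b t ≤ t
  countLE-bound t t≤N = ≤-from-complements {countLE a t} {length aboveA} {countLE b t} total L≤removed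
    where
    L = m + n ∸ t

    below? : Decidable (λ l → t < row (upOf l))
    below? l = t <? row (upOf l)

    lozengesBelow = filter below? ls
    aboveA        = filter (∁? λ i → a i ≤? t) (allFin m)
    aboveB        = filter (∁? λ j → b j ≤? t) (allFin n)
    removedLeft   = map (λ i → tri up (a i) 0) aboveA
    removedRight  = map (λ j → tri up (b j) (pred (x + b j))) aboveB
    #removed      = length aboveA + length aboveB

    ups⊆ : rowsBelow up t L ⊆ map upOf lozengesBelow ++ removedLeft ++ removedRight
    ups⊆ v∈ with R , k , refl , t<R , R≤t+L , k<w ← ∈-rowsBelow⁻ t L v∈
                with removed-or-inRegion (≤-trans (s≤s z≤n) t<R) (subst (R ≤_) (m+[n∸m]≡n t≤N) R≤t+L) k<w
    ... | inj₁ (refl , i , refl) =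
      ∈-++⁺ʳ (map upOf lozengesBelow)
        (∈-++⁺ˡ (∈-map⁺ _ (∈-filter⁺ (∁? λ i → a i ≤? t) (∈-allFin i) (<⇒≱ t<R))))
    ... | inj₂ (inj₁ (1+k≡ , j , refl)) =
      ∈-++⁺ʳ (map upOf lozengesBelow) (∈-++⁺ʳ removedLeft
        (subst (λ p → tri up (b j) p ∈ removedRight) (sym (cong pred 1+k≡))
          (∈-map⁺ _ (∈-filter⁺ (∁? λ j → b j ≤? t) (∈-allFin j) (<⇒≱ t<R)))))
    ... | inj₂ (inj₂ inRegion)
          with l , l∈ls , refl ← ∈-cells-up⁻ ls (Equivalence.from (covers _) inRegion) refl =
      ∈-++⁺ˡ (∈-map⁺ upOf (∈-filter⁺ below? l∈ls t<R))

    down∈rowsBelow : ∀ {v} → InRegion x m n a b v → orient v ≡ down → t < row v → v ∈ rowsBelow down t L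
    down∈rowsBelow {tri down R k} (_ , R≤N , 1+k<w) refl t<R =
      ∈-rowsBelow⁺ t L t<R (subst (R ≤_) (sym (m+[n∸m]≡n t≤N)) R≤N) (pred-mono-≤ 1+k<w)

    downs⊆ : map downOf lozengesBelow ⊆ rowsBelow down t L
    downs⊆ v∈ with l , l∈below , refl ← ∈-map⁻ downOf v∈
              with l∈ls , t<row ← ∈-filter⁻ below? {xs = ls} l∈below =
      down∈rowsBelow (Equivalence.to (covers _) (downOf∈cells l∈ls)) (orient-downOf l)
                     (<-≤-trans t<row (row-upOf≤row-downOf l))

    downs-unique : Unique (map downOf lozengesBelow)
    downs-unique =
      AllPairs.map⁺ (AllPairs.filter⁺ below? (AllPairs.map⁻ (unique-cells⇒unique-downOf ls (proj₂ tiling))))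

    L≤removed : L ≤ #removed
    L≤removed = +-cancelˡ-≤ (length (rowsBelow down t L)) L #removed (begin
      length (rowsBelow down t L) + L
        ≡⟨ length-rowsBelow t L ⟨
      length (rowsBelow up t L)
        ≤⟨ unique-⊆⇒length≤ (rowsBelow-unique up t L) ups⊆ ⟩
      length (map upOf lozengesBelow ++ removedLeft ++ removedRight)
        ≡⟨ length-++ (map upOf lozengesBelow) ⟩
      length (map upOf lozengesBelow) + length (removedLeft ++ removedRight)
        ≡⟨ cong₂ _+_ (trans (length-map upOf lozengesBelow) (sym (length-map downOf lozengesBelow)))
                     (trans (length-++ removedLeft) (cong₂ _+_ (length-map _ aboveA) (length-map _ aboveB))) ⟩
      length (map downOf lozengesBelow) + #removed
        ≤⟨ +-monoˡ-≤ #removed (unique-⊆⇒length≤ downs-unique downs⊆) ⟩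
      length (rowsBelow down t L) + #removed
        ∎)
      where open ≤-Reasoning

    total : (countLE a t + length aboveA) + (countLE b t + length aboveB) ≡ t + L
    total = trans (cong₂ _+_ (countLE+count> a t) (countLE+count> b t)) (sym (m+[n∸m]≡n t≤N))

module Sufficiency (x m n : ℕ) (a : Fin m → ℕ) (b : Fin n → ℕ)
    (a-bounds : ∀ i → 1 ≤ a i × a i ≤ m + n) (a-injective : Injective _≡_ _≡_ a)
    (b-bounds : ∀ j → 1 ≤ b j × b j ≤ m + n) (b-injective : Injective _≡_ _≡_ b)
    (countLE-bound : ∀ t → 1 ≤ t → t ≤ m + n → countLE a t + countLE b t ≤ t) where

  open Rows x

  N : ℕ
  N = m + n

  A B β : ℕ → ℕ
  A = countLE a
  B = countLE b
  β r = r ∸ B r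

  A+B≤ : ∀ {r} → r ≤ N → A r + B r ≤ r
  A+B≤ {zero}  _     =
    ≤-reflexive (cong₂ _+_ (countLE-zero a (proj₁ ∘ a-bounds)) (countLE-zero b (proj₁ ∘ b-bounds)))
  A+B≤ {suc r} 1+r≤N = countLE-bound (suc r) (s≤s z≤n) 1+r≤N

  A≤ : ∀ {r} → r ≤ N → A r ≤ r
  A≤ r≤N = ≤-trans (m≤m+n _ _) (A+B≤ r≤N)

  B≤ : ∀ {r} → r ≤ N → B r ≤ r
  B≤ r≤N = ≤-trans (m≤n+m _ _) (A+B≤ r≤N)

  A≤β : ∀ {r} → r ≤ N → A r ≤ β r
  A≤β r≤N = m+n≤o⇒m≤o∸n _ (A+B≤ r≤N)

  β≤ : ∀ r → β r ≤ r
  β≤ r = m∸n≤m r (B r)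

  InSeq-b⇒A< : ∀ {r} → r ≤ N → InSeq b r → A r < r
  InSeq-b⇒A< {r} r≤N b∋r = begin-strict
    A r          <⟨ m<m+n (A r) (InSeq⇒1≤countLE b b∋r) ⟩
    A r + B r    ≤⟨ A+B≤ r≤N ⟩
    r            ∎
    where open ≤-Reasoning

  A-suc-∈ : ∀ {r} → InSeq a (suc r) → A (suc r) ≡ suc (A r)
  A-suc-∈ = countLE-suc-∈ a a-injective

  A-suc-∉ : ∀ {r} → ¬ InSeq a (suc r) → A (suc r) ≡ A r
  A-suc-∉ = countLE-suc-∉ a

  β-suc-∈ : ∀ {r} → InSeq b (suc r) → β (suc r) ≡ β r
  β-suc-∈ b∋ = cong (suc _ ∸_) (countLE-suc-∈ b b-injective b∋)

  β-suc-∉ : ∀ {r} → r ≤ N → ¬ InSeq b (suc r) → β (suc r) ≡ suc (β r)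
  β-suc-∉ {r} r≤N b∌ = trans (cong (suc r ∸_) (countLE-suc-∉ b b∌)) (+-∸-assoc 1 (B≤ r≤N))

  β-N≡A-N : β N ≡ A N
  β-N≡A-N = begin
    N ∸ B N  ≡⟨ cong (N ∸_) (countLE-all b (proj₂ ∘ b-bounds)) ⟩
    N ∸ n    ≡⟨ m+n∸n≡m m n ⟩
    m        ≡⟨ countLE-all a (proj₂ ∘ a-bounds) ⟨
    A N      ∎
    where open ≡-Reasoning

  data Zone (r k : ℕ) : Set where
    left   : k < A r → Zone r k
    middle : A r ≤ k → k < β r → Zone r k
    right  : β r ≤ k → Zone r k

  zone : ∀ r k → Zone r k
  zone r k with k <? A r | k <? β r
  ... | yes k<A | _       = left k<A
  ... | no  k≮A | yes k<β = middle (≮⇒≥ k≮A) k<β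
  ... | no  _   | no  k≮β = right (≮⇒≥ k≮β)

  Zone-irrelevant : ∀ {r k} → r ≤ N → (z z′ : Zone r k) → z ≡ z′
  Zone-irrelevant _ (left p)     (left p′)      = cong left (<-irrelevant p p′)
  Zone-irrelevant _ (middle p q) (middle p′ q′) = cong₂ middle (≤-irrelevant p p′) (<-irrelevant q q′)
  Zone-irrelevant _ (right p)    (right p′)     = cong right (≤-irrelevant p p′)
  Zone-irrelevant _ (left k<A)   (middle A≤k _) = contradiction k<A (≤⇒≯ A≤k)
  Zone-irrelevant _ (middle A≤k _) (left k<A)   = contradiction k<A (≤⇒≯ A≤k)
  Zone-irrelevant _ (middle _ k<β) (right β≤k)  = contradiction k<β (≤⇒≯ β≤k)
  Zone-irrelevant _ (right β≤k) (middle _ k<β)  = contradiction k<β (≤⇒≯ β≤k)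
  Zone-irrelevant r≤N (left k<A) (right β≤k)    = contradiction k<A (≤⇒≯ (≤-trans (A≤β r≤N) β≤k))
  Zone-irrelevant r≤N (right β≤k) (left k<A)    = contradiction k<A (≤⇒≯ (≤-trans (A≤β r≤N) β≤k))

  -- The lozenge covering the down triangle at position k of row r + 1.
  matchIn : ∀ {r k} → Zone r k → Lozenge
  matchIn {r} {k} (left _)     = horizontal (InSeq? a (suc r)) (suc r) k
  matchIn {r} {k} (middle _ _) = vertical r k
  matchIn {r} {k} (right _)    = horizontal (¬? (InSeq? b (suc r))) (suc r) k

  match : ℕ → ℕ → Lozenge
  match r k = matchIn (zone r k)

  match≡matchIn : ∀ {r k} → r ≤ N → (z : Zone r k) → match r k ≡ matchIn z
  match≡matchIn r≤N z = cong matchIn (Zone-irrelevant r≤N (zone _ _) z)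

  downOf-match : ∀ r k → downOf (match r k) ≡ tri down (suc r) k
  downOf-match r k with zone r k
  ... | left _     = downOf-horizontal (InSeq? a (suc r)) (suc r) k
  ... | middle _ _ = refl
  ... | right _    = downOf-horizontal (¬? (InSeq? b (suc r))) (suc r) k

  upOf-match-left-∈ : ∀ {r k} → r ≤ N → k < A r → InSeq a (suc r) →
    upOf (match r k) ≡ tri up (suc r) (suc k)
  upOf-match-left-∈ {r} r≤N k<A a∋ rewrite match≡matchIn r≤N (left k<A) with InSeq? a (suc r)
  ... | yes _ = refl
  ... | no a∌ = contradiction a∋ a∌

  upOf-match-left-∉ : ∀ {r k} → r ≤ N → k < A r → ¬ InSeq a (suc r) →
    upOf (match r k) ≡ tri up (suc r) k
  upOf-match-left-∉ {r} r≤N k<A a∌ rewrite match≡matchIn r≤N (left k<A) with InSeq? a (suc r)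
  ... | yes a∋ = contradiction a∋ a∌
  ... | no _   = refl

  upOf-match-middle : ∀ {r k} → r ≤ N → A r ≤ k → k < β r →
    upOf (match r k) ≡ tri up r k
  upOf-match-middle r≤N A≤k k<β rewrite match≡matchIn r≤N (middle A≤k k<β) = refl

  upOf-match-right-∈ : ∀ {r k} → r ≤ N → β r ≤ k → InSeq b (suc r) →
    upOf (match r k) ≡ tri up (suc r) k
  upOf-match-right-∈ {r} r≤N β≤k b∋ rewrite match≡matchIn r≤N (right β≤k) with InSeq? b (suc r)
  ... | yes _ = refl
  ... | no b∌ = contradiction b∋ b∌

  upOf-match-right-∉ : ∀ {r k} → r ≤ N → β r ≤ k → ¬ InSeq b (suc r) →
    upOf (match r k) ≡ tri up (suc r) (suc k)
  upOf-match-right-∉ {r} r≤N β≤k b∌ rewrite match≡matchIn r≤N (right β≤k) with InSeq? b (suc r)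
  ... | yes b∋ = contradiction b∋ b∌
  ... | no _   = refl

  sourceIn : ∀ {R p} → Zone R p → Bool → Bool → ℕ × ℕ
  sourceIn {R} {p} (left _)     true  _     = pred R , pred p
  sourceIn {R} {p} (left _)     false _     = pred R , p
  sourceIn {R} {p} (middle _ _) _     _     = R , p
  sourceIn {R} {p} (right _)    _     true  = pred R , p
  sourceIn {R} {p} (right _)    _     false = pred R , pred p

  -- For an up triangle, the indices (r , k) of the down triangle of row r + 1 matched with it.
  source : Triangle → ℕ × ℕ
  source (tri _ R p) = sourceIn (zone R p) (does (InSeq? a R)) (does (InSeq? b R))

  source≡sourceIn : ∀ {o R p ba bb} → R ≤ N → (z : Zone R p) →
    does (InSeq? a R) ≡ ba → does (InSeq? b R) ≡ bb → source (tri o R p) ≡ sourceIn z ba bb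
  source≡sourceIn R≤N z refl refl = cong (λ z → sourceIn z _ _) (Zone-irrelevant R≤N (zone _ _) z)

  source-match : ∀ {r k} → suc r ≤ N → source (upOf (match r k)) ≡ (r , k)
  source-match {r} {k} 1+r≤N = byZone (zone r k) (InSeq? a (suc r)) (InSeq? b (suc r))
    where
    r≤N = <⇒≤ 1+r≤N
    byZone : Zone r k → Dec (InSeq a (suc r)) → Dec (InSeq b (suc r)) → source (upOf (match r k)) ≡ (r , k)
    byZone (left k<A) (yes a∋) _ = trans (cong source (upOf-match-left-∈ r≤N k<A a∋))
      (source≡sourceIn {up} 1+r≤N (left (subst (suc k <_) (sym (A-suc-∈ a∋)) (s≤s k<A)))
                       (dec-true (InSeq? a (suc r)) a∋) refl)
    byZone (left k<A) (no a∌) _ = trans (cong source (upOf-match-left-∉ r≤N k<A a∌))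
      (source≡sourceIn {up} 1+r≤N (left (subst (k <_) (sym (A-suc-∉ a∌)) k<A))
                       (dec-false (InSeq? a (suc r)) a∌) refl)
    byZone (middle A≤k k<β) _ _ = trans (cong source (upOf-match-middle r≤N A≤k k<β))
      (source≡sourceIn {up} r≤N (middle A≤k k<β) refl refl)
    byZone (right β≤k) _ (yes b∋) = trans (cong source (upOf-match-right-∈ r≤N β≤k b∋))
      (source≡sourceIn {up} 1+r≤N (right (subst (_≤ k) (sym (β-suc-∈ b∋)) β≤k))
                       refl (dec-true (InSeq? b (suc r)) b∋))
    byZone (right β≤k) _ (no b∌) = trans (cong source (upOf-match-right-∉ r≤N β≤k b∌))
      (source≡sourceIn {up} 1+r≤N (right (subst (_≤ suc k) (sym (β-suc-∉ r≤N b∌)) (s≤s β≤k)))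
                       refl (dec-false (InSeq? b (suc r)) b∌))

  match-inRegion : ∀ {r k} → suc r ≤ N → k < x + r → InRegion x m n a b (upOf (match r k))
  match-inRegion {r} {k} 1+r≤N k<w = byZone (zone r k) (InSeq? a (suc r)) (InSeq? b (suc r))
    where
    r≤N = <⇒≤ 1+r≤N
    <x+1+r : ∀ {q} → q < suc r → q < x + suc r
    <x+1+r q<1+r = <-≤-trans q<1+r (m≤n+m (suc r) x)
    1+k<w = <⇒suc<+suc x r k<w

    byZone : Zone r k → Dec (InSeq a (suc r)) → Dec (InSeq b (suc r)) → InRegion x m n a b (upOf (match r k))
    byZone (left k<A) (yes a∋) _ = subst (InRegion x m n a b) (sym (upOf-match-left-∈ r≤N k<A a∋))
      ( s≤s z≤n , 1+r≤N , <x+1+r (s≤s (≤-trans k<A (A≤ r≤N))) , (λ { (() , _) })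
      , λ (last , b∋) → <⇒≢ (≤-<-trans (subst (suc (suc k) ≤_) (sym (A-suc-∈ a∋)) (s≤s k<A))
                                        (<x+1+r (InSeq-b⇒A< 1+r≤N b∋))) last )
    byZone (left k<A) (no a∌) _ = subst (InRegion x m n a b) (sym (upOf-match-left-∉ r≤N k<A a∌))
      ( s≤s z≤n , 1+r≤N , <x+1+r (≤-trans k<A (≤-trans (A≤ r≤N) (n≤1+n r))) , (λ (_ , a∋) → a∌ a∋)
      , λ (last , b∋) → <⇒≢ (≤-<-trans (subst (suc k ≤_) (sym (A-suc-∉ a∌)) k<A)
                                        (<x+1+r (InSeq-b⇒A< 1+r≤N b∋))) last )
    byZone (middle A≤k k<β) _ _ = subst (InRegion x m n a b) (sym (upOf-match-middle r≤N A≤k k<β))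
      ( ≤-trans (s≤s z≤n) k<r , r≤N , <-≤-trans k<r (m≤n+m r x)
      , (λ (k≡0 , a∋) → <⇒≢ (≤-trans (InSeq⇒1≤countLE a a∋) A≤k) (sym k≡0))
      , λ (last , b∋) → <⇒≢ (<-≤-trans (2+k≤r b∋) (m≤n+m r x)) last )
      where
      k<r : k < r
      k<r = <-≤-trans k<β (β≤ r)
      2+k≤r : InSeq b r → suc (suc k) ≤ r
      2+k≤r b∋ = ≤-trans
        (subst (_≤ suc k + B r) (+-comm (suc k) 1) (+-monoʳ-≤ (suc k) (InSeq⇒1≤countLE b b∋)))
        (m≤o∸n⇒m+n≤o (suc k) (B≤ r≤N) k<β)
    byZone (right β≤k) _ (yes b∋) = subst (InRegion x m n a b) (sym (upOf-match-right-∈ r≤N β≤k b∋))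
      ( s≤s z≤n , 1+r≤N , <-trans (n<1+n k) 1+k<w
      , (λ (k≡0 , a∋) → <⇒≱ (+-mono-≤ (InSeq⇒1≤countLE a a∋) (1+r≤B b∋ k≡0)) (A+B≤ 1+r≤N))
      , λ (last , _) → <⇒≢ 1+k<w last )
      where
      1+r≤B : InSeq b (suc r) → k ≡ 0 → suc r ≤ B (suc r)
      1+r≤B b∋ k≡0 = subst (suc r ≤_) (sym (countLE-suc-∈ b b-injective b∋))
                       (s≤s (m∸n≡0⇒m≤n (n≤0⇒n≡0 (subst (β r ≤_) k≡0 β≤k))))
    byZone (right β≤k) _ (no b∌) = subst (InRegion x m n a b) (sym (upOf-match-right-∉ r≤N β≤k b∌))
      (s≤s z≤n , 1+r≤N , 1+k<w , (λ { (() , _) }) , λ (_ , b∋) → b∌ b∋)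

  match-surjective : ∀ {R p} → InRegion x m n a b (tri up R p) →
    ∃₂ λ r k → suc r ≤ N × k < x + r × upOf (match r k) ≡ tri up R p
  match-surjective {suc r} {p} (_ , 1+r≤N , inRow) =
    byZone inRow (zone (suc r) p) (InSeq? a (suc r)) (InSeq? b (suc r))
    where
    r≤N = <⇒≤ 1+r≤N
    <x+r : ∀ {q} → q < A r → q < x + r
    <x+r q<A = <-≤-trans q<A (≤-trans (A≤ r≤N) (m≤n+m r x))

    byZone : ∀ {p} → p < x + suc r × ¬ (p ≡ 0 × InSeq a (suc r)) × ¬ (suc p ≡ x + suc r × InSeq b (suc r)) →
      Zone (suc r) p → Dec (InSeq a (suc r)) → Dec (InSeq b (suc r)) →
      ∃₂ λ r′ k → suc r′ ≤ N × k < x + r′ × upOf (match r′ k) ≡ tri up (suc r) p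
    byZone {zero} (_ , ¬removedLeft , _) (left _) (yes a∋) _ = contradiction (refl , a∋) ¬removedLeft
    byZone {suc k} _ (left p<A) (yes a∋) _ =
      r , k , 1+r≤N , <x+r k<A , upOf-match-left-∈ r≤N k<A a∋
      where k<A = ≤-pred (subst (suc k <_) (A-suc-∈ a∋) p<A)
    byZone {p} _ (left p<A) (no a∌) _ =
      r , p , 1+r≤N , <x+r p<A′ , upOf-match-left-∉ r≤N p<A′ a∌
      where p<A′ = subst (p <_) (A-suc-∉ a∌) p<A
    byZone {p} (p<w , _) (middle A≤p p<β) _ _ =
      suc r , p , ≤∧≢⇒< 1+r≤N 1+r≢N , p<w , upOf-match-middle 1+r≤N A≤p p<β
      where
      1+r≢N : suc r ≢ N
      1+r≢N 1+r≡N = <⇒≱ p<β (subst (_≤ p) (sym (subst (λ R → β R ≡ A R) (sym 1+r≡N) β-N≡A-N)) A≤p)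
    byZone {p} (p<w , _ , ¬removedRight) (right β≤p) _ (yes b∋) =
      r , p , 1+r≤N , suc<+suc⇒< x r (≤∧≢⇒< p<w λ last → ¬removedRight (last , b∋))
        , upOf-match-right-∈ r≤N (subst (_≤ p) (β-suc-∈ b∋) β≤p) b∋
    byZone {p} (p<w , _) (right β≤p) _ (no b∌) with p | subst (_≤ p) (β-suc-∉ r≤N b∌) β≤p
    ... | suc k | s≤s β≤k = r , k , 1+r≤N , suc<+suc⇒< x r p<w , upOf-match-right-∉ r≤N β≤k b∌

  downTriangles : List Triangle
  downTriangles = rowsBelow down 0 N

  ∈-downTriangles⁻ : ∀ {d} → d ∈ downTriangles → ∃₂ λ r k → d ≡ tri down (suc r) k × suc r ≤ N × k < x + r
  ∈-downTriangles⁻ d∈ with ∈-rowsBelow⁻ 0 N d∈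
  ... | suc r , k , refl , _ , 1+r≤N , k<w = r , k , refl , 1+r≤N , subst (k <_) (cong pred (+-suc x r)) k<w

  ∈-downTriangles⁺ : ∀ {r k} → suc r ≤ N → k < x + r → tri down (suc r) k ∈ downTriangles
  ∈-downTriangles⁺ {r} {k} 1+r≤N k<w =
    ∈-rowsBelow⁺ 0 N (s≤s z≤n) 1+r≤N (subst (k <_) (sym (cong pred (+-suc x r))) k<w)

  lozengeOver : Triangle → Lozenge
  lozengeOver d = match (pred (row d)) (pos d)

  lozenges : List Lozenge
  lozenges = map lozengeOver downTriangles

  covers : ∀ v → v ∈ cells lozenges ⇔ InRegion x m n a b v
  covers _ = mk⇔ covered⇒inRegion inRegion⇒covered
    where
    covered⇒inRegion : ∀ {v} → v ∈ cells lozenges → InRegion x m n a b v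
    covered⇒inRegion v∈ with l , l∈ , v≡ ← ∈-cells⁻ lozenges v∈
                        with d , d∈ , refl ← ∈-map⁻ lozengeOver l∈
                        with r , k , refl , 1+r≤N , k<w ← ∈-downTriangles⁻ d∈
                        with v≡
    ... | inj₁ refl = match-inRegion 1+r≤N k<w
    ... | inj₂ refl = subst (InRegion x m n a b) (sym (downOf-match r k)) (s≤s z≤n , 1+r≤N , <⇒suc<+suc x r k<w)

    inRegion⇒covered : ∀ {v} → InRegion x m n a b v → v ∈ cells lozenges
    inRegion⇒covered {tri up _ _} inRegion with r , k , 1+r≤N , k<w , up≡ ← match-surjective inRegion =
      subst (_∈ cells lozenges) up≡ (upOf∈cells (∈-map⁺ lozengeOver (∈-downTriangles⁺ 1+r≤N k<w)))
    inRegion⇒covered {tri down (suc r) k} (_ , 1+r≤N , 1+k<w) =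
      subst (_∈ cells lozenges) (downOf-match r k)
        (downOf∈cells (∈-map⁺ lozengeOver (∈-downTriangles⁺ 1+r≤N (suc<+suc⇒< x r 1+k<w))))

  lozenges-unique : Unique (cells lozenges)
  lozenges-unique = cells-unique lozenges (unique-map upOf upOf-injective) (unique-map downOf downOf-injective)
    where
    InjectiveOnDowns : (Lozenge → Triangle) → Set
    InjectiveOnDowns f = ∀ {d d′} → d ∈ downTriangles → d′ ∈ downTriangles →
                         f (lozengeOver d) ≡ f (lozengeOver d′) → d ≡ d′

    unique-map : ∀ f → InjectiveOnDowns f → Unique (map f lozenges)
    unique-map f inj = subst Unique (map-∘ downTriangles) (map⁺-injectiveOn inj (rowsBelow-unique down 0 N))

    upOf-injective : InjectiveOnDowns upOf
    upOf-injective d∈ d′∈ up≡ with r , k , refl , 1+r≤N , _ ← ∈-downTriangles⁻ d∈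
                              with r′ , k′ , refl , 1+r′≤N , _ ← ∈-downTriangles⁻ d′∈ =
      cong (λ (r , k) → tri down (suc r) k)
           (trans (sym (source-match 1+r≤N)) (trans (cong source up≡) (source-match 1+r′≤N)))

    downOf-injective : InjectiveOnDowns downOf
    downOf-injective d∈ d′∈ down≡ with r , k , refl , _ ← ∈-downTriangles⁻ d∈
                                  with r′ , k′ , refl , _ ← ∈-downTriangles⁻ d′∈ =
      trans (sym (downOf-match r k)) (trans down≡ (downOf-match r′ k′))

  tileable : Tileable x m n a b
  tileable = lozenges , covers , lozenges-unique

lemma2p1 : (x m n : ℕ) (a : Fin m → ℕ) (b : Fin n → ℕ)
    → (∀ i → 1 ≤ a i × a i ≤ m + n)
    → (∀ i j → i Data.Fin.< j → a i < a j)
    → (∀ j → 1 ≤ b j × b j ≤ m + n)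
    → (∀ i j → i Data.Fin.< j → b i < b j)
    → Tileable x m n a b ⇔ (∀ t → 1 ≤ t → t ≤ m + n → countLE a t + countLE b t ≤ t)
lemma2p1 x m n a b a-bounds a-increasing b-bounds b-increasing = mk⇔
  (λ (ls , tiling) t _ t≤N → Necessity.countLE-bound x m n a b ls tiling t t≤N)
  (λ countLE-bound → Sufficiency.tileable x m n a b
     a-bounds (strictMono⇒injective a-increasing) b-bounds (strictMono⇒injective b-increasing) countLE-bound)
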